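{- There exists an infinite word over the alphabet $\{0,1,2,3\}$ that is squarefree and contains no occurrence of any of the subwords $12$, $13$, $21$, $32$, $231$, $10302$.
   Context: A subword (factor) of a word is a contiguous block of it. A square is a nonempty word of the form $xx$; a word is squarefree if no subword of it is a square. An infinite word over an alphabet $\Sigma$ is a map $\mathbb{N}\to\Sigma$. -}

module Defs where

open import Data.Nat using (ℕ; zero; suc; _+_; _<_)
open import Data.Fin using (Fin)
open import Data.List using (List; []; _∷_; length; lookup)
open import Data.Product using (Σ; ∃; _×_)
open import Relation.Nullary using (¬_)
open import Relation.Binary.PropositionalEquality using (_≡_)

InfWord : Set → Set
InfWord A = ℕ → A

OccursAt : {A : Set} → InfWord A → List A → ℕ → Set
OccursAt w u i = (k : Fin (length u)) → w (i + Data.Fin.toℕ k) ≡ lookup u k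

IsFactor : {A : Set} → List A → InfWord A → Set
IsFactor u w = ∃ λ i → OccursAt w u i

HasSquare : {A : Set} → InfWord A → Set
HasSquare w = ∃ λ i → ∃ λ n → (0 < n) × ((k : ℕ) → k < n → w (i + k) ≡ w (i + n + k))

SquareFree : {A : Set} → InfWord A → Set
SquareFree w = ¬ HasSquare w

Letter : Set
Letter = Fin 4

l0 l1 l2 l3 : Letter
l0 = Data.Fin.zero
l1 = Data.Fin.suc Data.Fin.zero
l2 = Data.Fin.suc (Data.Fin.suc Data.Fin.zero)
l3 = Data.Fin.suc (Data.Fin.suc (Data.Fin.suc Data.Fin.zero))

forbidden : List (List Letter)
forbidden =
  (l1 ∷ l2 ∷ []) ∷ (l1 ∷ l3 ∷ []) ∷ (l2 ∷ l1 ∷ []) ∷ (l3 ∷ l2 ∷ []) ∷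
  (l2 ∷ l3 ∷ l1 ∷ []) ∷ (l1 ∷ l0 ∷ l3 ∷ l0 ∷ l2 ∷ []) ∷ []

-- The word is the fixed point w = h^ω(0) of the 7-uniform morphism h below. Every factor of w
-- of length at most 50 starting at i lies in h²(ab), at offset i % 49, where ab = w (i / 49)
-- w (i / 49 + 1) is one of the eight two-letter factors of w. So the absence of the forbidden
-- words and of squares of period < 12 reduces to a finite check over 8 × 49 windows. The same
-- check shows that a factor of length 12 determines its starting position modulo 7, so a square
-- of period n ≥ 12 has 7 ∣ n. Since the letter at position 3 of h(a) determines a, reading such a
-- square at the positions ≡ 3 (mod 7) gives a square of period n / 7 in w, and induction on the
-- period rules out all squares.
module Submission where

open import Defs
open import Data.Nat
  using (ℕ; zero; suc; _+_; _*_; _∸_; _^_; _≤_; _<_; z≤n; s≤s; z<s; s<s; _/_; _%_; _<?_; _≤ᵇ_; NonZero; >-nonZero; pred)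
open import Data.Nat.Properties
open import Data.Nat.DivMod
open import Data.Nat.Divisibility using (_∣_; divides; divides-refl; ∣m+n∣m⇒∣n)
open import Data.Nat.Induction using (<-rec)
open import Data.Nat.Tactic.RingSolver using (solve-∀)
open import Data.Fin using (Fin; toℕ)
open import Data.Fin.Patterns using (0F; 1F; 2F; 3F)
open import Data.Fin.Properties using (toℕ<n; fromℕ<-cong; fromℕ<-toℕ) renaming (_≟_ to _≟ᶠ_)
open import Data.Vec using (Vec; []; _∷_; lookup)
open import Data.List using (List; []; _∷_; length; downFrom; allFin)
import Data.List as List
open import Data.Bool using (Bool; true; false; not; _∧_; _∨_; T)
open import Data.Bool.ListAction using (all; any)
open import Data.Bool.Properties using (T-≡; T-∧)
open import Data.List.Relation.Unary.All as All using (All)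
open import Data.List.Relation.Unary.All.Properties using (all⁺; all⁻; applyDownFrom⁺₁; tabulate⁺)
open import Data.List.Relation.Unary.Any using (here)
open import Data.List.Relation.Unary.Any.Properties using (any⁺)
open import Data.List.Membership.Propositional using (_∈_; lose)
open import Data.List.Membership.Propositional.Properties using (∈-downFrom⁺; ∈-allFin)
open import Data.List.Membership.DecPropositional (_≟ᶠ_ {4}) using (_∈?_)
open import Data.Product using (∃; ∃₂; _×_; _,_)
open import Function using (id; const; _∘_; case_of_)
open import Function.Bundles using (Equivalence)
open import Relation.Nullary using (¬_; yes; no)
open import Relation.Nullary.Decidable using (⌊_⌋; toWitness; fromWitness)
open import Relation.Binary.PropositionalEquality

interval-meets-residue : ∀ L ⦃ _ : NonZero L ⦄ i {r} → r < L →
                         ∃₂ λ d q → d < L × i + d ≡ r + q * L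
interval-meets-residue L zero {r} r<L = r , 0 , r<L , sym (+-identityʳ r)
interval-meets-residue L (suc i) {r} r<L with interval-meets-residue L i r<L
... | suc d , q , d<L , eq = d , q , <-trans (n<1+n d) d<L , trans (sym (+-suc i d)) eq
... | zero  , q , _   , eq = pred L , suc q , ≤-reflexive (suc-pred L) , (begin
  suc i + pred L    ≡⟨ +-comm (suc i) (pred L) ⟩
  pred L + suc i    ≡⟨ +-suc (pred L) i ⟩
  suc (pred L + i)  ≡⟨ cong (_+ i) (suc-pred L) ⟩
  L + i             ≡⟨ cong (L +_) (trans (sym (+-identityʳ i)) eq) ⟩
  L + (r + q * L)   ≡⟨ swap L r (q * L) ⟩
  r + suc q * L     ∎)
  where
  open ≡-Reasoning
  swap : ∀ x y z → x + (y + z) ≡ y + (x + z)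
  swap = solve-∀

%-≡⇒∣ : ∀ m n d ⦃ _ : NonZero d ⦄ → m % d ≡ (m + n) % d → d ∣ n
%-≡⇒∣ m n d eq = ∣m+n∣m⇒∣n (divides ((m + n) / d) (+-cancelˡ-≡ (m % d) _ _ (begin
  m % d + (m / d * d + n)        ≡⟨ +-assoc (m % d) (m / d * d) n ⟨
  m % d + m / d * d + n          ≡⟨ cong (_+ n) (m≡m%n+[m/n]*n m d) ⟨
  m + n                          ≡⟨ m≡m%n+[m/n]*n (m + n) d ⟩
  (m + n) % d + (m + n) / d * d  ≡⟨ cong (_+ (m + n) / d * d) eq ⟨
  m % d + (m + n) / d * d        ∎))) (divides-refl (m / d))
  where open ≡-Reasoning

*-rotate : ∀ q x y → q * (x * y) ≡ q * y * x
*-rotate = solve-∀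

Square : {A : Set} → InfWord A → ℕ → ℕ → Set
Square w i n = (k : ℕ) → k < n → w (i + k) ≡ w (i + n + k)

square-transfer : ∀ {A : Set} {g f : InfWord A} {i n M} → (∀ k → k < M → g (i + k) ≡ f k) →
                  n + n ≤ M → Square g i n → Square f 0 n
square-transfer {g = g} {f} {i} {n} g≡f 2n≤M square k k<n = begin
  f k              ≡⟨ g≡f k (<-≤-trans (<-≤-trans k<n (m≤m+n n n)) 2n≤M) ⟨
  g (i + k)        ≡⟨ square k k<n ⟩
  g (i + n + k)    ≡⟨ cong g (+-assoc i n k) ⟩
  g (i + (n + k))  ≡⟨ g≡f (n + k) (<-≤-trans (+-monoʳ-< n k<n) 2n≤M) ⟩
  f (n + k)        ∎
  where open ≡-Reasoning

module UniformMorphism {A : Set} {L : ℕ} ⦃ _ : NonZero L ⦄ (φ : A → Vec A L) where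

  image : InfWord A → InfWord A
  image f j = lookup (φ (f (j / L))) (j mod L)

  image^ : ℕ → InfWord A → InfWord A
  image^ zero    f = f
  image^ (suc n) f = image (image^ n f)

  suffix : ℕ → InfWord A → InfWord A
  suffix q f m = f (m + q)

  -- The word a b b b …, of which only the first two letters are ever read.
  pair : A → A → InfWord A
  pair a b zero    = a
  pair a b (suc _) = b

  image-local : ∀ f g j → f (j / L) ≡ g (j / L) → image f j ≡ image g j
  image-local f g j eq = cong (λ a → lookup (φ a) (j mod L)) eq

  image-cong : ∀ {f g} → f ≗ g → image f ≗ image g
  image-cong {f} {g} f≗g j = image-local f g j (f≗g (j / L))

  suffix-image : ∀ q f → suffix (q * L) (image f) ≗ image (suffix q f)
  suffix-image q f m = cong₂ (λ x y → lookup (φ (f x)) y) quotient remainder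
    where
    quotient : (m + q * L) / L ≡ m / L + q
    quotient = trans (+-distrib-/-∣ʳ m (divides-refl q)) (cong (m / L +_) (m*n/n≡m q L))
    remainder : (m + q * L) mod L ≡ m mod L
    remainder = fromℕ<-cong _ _ ([m+kn]%n≡m%n m q L) _ _

  suffix-image^ : ∀ n q f → suffix (q * L ^ n) (image^ n f) ≗ image^ n (suffix q f)
  suffix-image^ zero    q f m = cong (λ x → f (m + x)) (*-identityʳ q)
  suffix-image^ (suc n) q f m = begin
    image (image^ n f) (m + q * (L * L ^ n))   ≡⟨ cong (λ x → image (image^ n f) (m + x)) (*-rotate q L _) ⟩
    image (image^ n f) (m + q * L ^ n * L)     ≡⟨ suffix-image (q * L ^ n) (image^ n f) m ⟩
    image (suffix (q * L ^ n) (image^ n f)) m  ≡⟨ image-cong (suffix-image^ n q f) m ⟩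
    image (image^ n (suffix q f)) m            ∎
    where open ≡-Reasoning

  image^-local : ∀ n {M f g} → (∀ x → x < M → f x ≡ g x) →
                 ∀ m → m < M * L ^ n → image^ n f m ≡ image^ n g m
  image^-local zero    {M} f≡g m m<M = f≡g m (subst (m <_) (*-identityʳ M) m<M)
  image^-local (suc n) {M} {f} {g} f≡g m m<M =
    image-local (image^ n f) (image^ n g) m (image^-local n f≡g (m / L) (m<n*o⇒m/o<n m<M'))
    where
    m<M' : m < M * L ^ n * L
    m<M' = subst (m <_) (*-rotate M L (L ^ n)) m<M

  suffix-pair : ∀ q f x → x < 2 → suffix q f x ≡ pair (f q) (f (suc q)) x
  suffix-pair q f zero          _ = refl
  suffix-pair q f (suc zero)    _ = refl
  suffix-pair q f (suc (suc x)) (s<s (s<s ()))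

  image^-factor : ∀ n f q {r k} → r < L ^ n → k ≤ L ^ n →
                  image^ n f (r + q * L ^ n + k) ≡ image^ n (pair (f q) (f (suc q))) (r + k)
  image^-factor n f q {r} {k} r<N k≤N = begin
    image^ n f (r + q * L ^ n + k)             ≡⟨ cong (image^ n f) (swap r (q * L ^ n) k) ⟩
    image^ n f (r + k + q * L ^ n)             ≡⟨ suffix-image^ n q f (r + k) ⟩
    image^ n (suffix q f) (r + k)              ≡⟨ image^-local n (suffix-pair q f) (r + k) r+k<2N ⟩
    image^ n (pair (f q) (f (suc q))) (r + k)  ∎
    where
    open ≡-Reasoning
    swap : ∀ x y z → x + y + z ≡ x + z + y
    swap = solve-∀
    r+k<2N : r + k < 2 * L ^ n
    r+k<2N = ≤-trans (+-mono-<-≤ r<N k≤N) (≤-reflexive (cong (L ^ n +_) (sym (+-identityʳ _))))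

  image^-fixed : ∀ {f} → f ≗ image f → ∀ n → f ≗ image^ n f
  image^-fixed fixed zero    j = refl
  image^-fixed fixed (suc n) j = trans (fixed j) (image-cong (image^-fixed fixed n) j)

  image-block : ∀ f (p : Fin L) j → image f (toℕ p + j * L) ≡ lookup (φ (f j)) p
  image-block f p j = trans (suffix-image j f (toℕ p))
    (cong₂ (λ x y → lookup (φ (f x)) y) (cong (_+ j) (m<n⇒m/n≡0 (toℕ<n p)))
           (trans (fromℕ<-cong _ _ (m<n⇒m%n≡m (toℕ<n p)) _ _) (fromℕ<-toℕ p (toℕ<n p))))

  -- Inside a square of period m * L, the letters at the positions ≡ p (mod L) are the p-th letters of
  -- the images of a run of m consecutive letters of f, and they determine those letters.
  square-descent : ∀ {f} → f ≗ image f → (p : Fin L) →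
                   (∀ {a b} → lookup (φ a) p ≡ lookup (φ b) p → a ≡ b) →
                   ∀ {i m} → Square f i (m * L) → ∃ λ j → Square f j m
  square-descent {f} fixed p marks {i} {m} square
    with d , q , d<L , i+d≡p+qL ← interval-meets-residue L i (toℕ<n p)
    = q , λ k k<m → marks (begin
      lookup (φ (f (q + k))) p              ≡⟨ block (q + k) ⟨
      f (toℕ p + (q + k) * L)               ≡⟨ cong f (position k) ⟨
      f (i + (d + k * L))                   ≡⟨ square (d + k * L) (offset<m*L k<m) ⟩
      f (i + m * L + (d + k * L))           ≡⟨ cong f (rearrange i (m * L) d (k * L)) ⟩
      f (i + (d + (m * L + k * L)))         ≡⟨ cong (λ x → f (i + (d + x))) (*-distribʳ-+ L m k) ⟨
      f (i + (d + (m + k) * L))             ≡⟨ cong f (position (m + k)) ⟩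
      f (toℕ p + (q + (m + k)) * L)         ≡⟨ block (q + (m + k)) ⟩
      lookup (φ (f (q + (m + k)))) p        ≡⟨ cong (λ x → lookup (φ (f x)) p) (+-assoc q m k) ⟨
      lookup (φ (f (q + m + k))) p          ∎)
    where
    open ≡-Reasoning
    block : ∀ j → f (toℕ p + j * L) ≡ lookup (φ (f j)) p
    block j = trans (fixed _) (image-block f p j)
    rearrange : ∀ w x y z → w + x + (y + z) ≡ w + (y + (x + z))
    rearrange = solve-∀
    position : ∀ k → i + (d + k * L) ≡ toℕ p + (q + k) * L
    position k = begin
      i + (d + k * L)          ≡⟨ +-assoc i d (k * L) ⟨
      i + d + k * L            ≡⟨ cong (_+ k * L) i+d≡p+qL ⟩
      toℕ p + q * L + k * L    ≡⟨ +-assoc (toℕ p) (q * L) (k * L) ⟩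
      toℕ p + (q * L + k * L)  ≡⟨ cong (toℕ p +_) (*-distribʳ-+ L q k) ⟨
      toℕ p + (q + k) * L      ∎
    offset<m*L : ∀ {k} → k < m → d + k * L < m * L
    offset<m*L k<m = ≤-trans (+-monoˡ-< _ d<L) (*-monoˡ-≤ L k<m)

  module FixedPoint (1<L : 1 < L) (a : A) (φa-begins-with-a : lookup (φ a) (0 mod L) ≡ a) where

    -- The first n + 1 letters of φⁿ(a) are already those of the fixed point.
    fixedPoint : InfWord A
    fixedPoint n = image^ n (const a) n

    private
      /-shrinks : ∀ {n k} → n ≤ suc k → n / L ≤ k
      /-shrinks {zero}  {k} _   = subst (_≤ k) (sym (0/n≡0 L)) z≤n
      /-shrinks {suc n}     n≤k = ≤-pred (≤-trans (m/n<m (suc n) L 1<L) n≤k)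

      image^-const-step : ∀ k {n} → n ≤ k → image^ k (const a) n ≡ image^ (suc k) (const a) n
      image^-const-step zero    z≤n = sym φa-begins-with-a
      image^-const-step (suc k) {n} n≤k =
        image-local (image^ k (const a)) (image^ (suc k) (const a)) n
                    (image^-const-step k (/-shrinks n≤k))

      image^-const-settled : ∀ {k n} → n ≤ k → image^ k (const a) n ≡ fixedPoint n
      image^-const-settled {k} {n} n≤k =
        subst (λ x → image^ x (const a) n ≡ fixedPoint n) (m∸n+n≡m n≤k) (settled-after (k ∸ n))
        where
        settled-after : ∀ d → image^ (d + n) (const a) n ≡ fixedPoint n
        settled-after zero    = refl
        settled-after (suc d) = trans (sym (image^-const-step (d + n) (m≤n+m n d))) (settled-after d)

    fixedPoint-fixed : fixedPoint ≗ image fixedPoint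
    fixedPoint-fixed j = trans (image^-const-step j ≤-refl)
      (image-local (image^ j (const a)) fixedPoint j (image^-const-settled (m/n≤m j L)))

h : Letter → Vec Letter 7
h 0F = 0F ∷ 1F ∷ 0F ∷ 3F ∷ 1F ∷ 0F ∷ 2F ∷ []
h 1F = 0F ∷ 3F ∷ 0F ∷ 1F ∷ 0F ∷ 2F ∷ 3F ∷ []
h 2F = 3F ∷ 0F ∷ 1F ∷ 0F ∷ 2F ∷ 0F ∷ 3F ∷ []
h 3F = 0F ∷ 1F ∷ 0F ∷ 2F ∷ 3F ∷ 0F ∷ 2F ∷ []

open UniformMorphism h
open FixedPoint (s<s z<s) 0F refl renaming (fixedPoint to w; fixedPoint-fixed to w-fixed)

decode-position-3 : Letter → Letter
decode-position-3 3F = 0F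
decode-position-3 1F = 1F
decode-position-3 0F = 2F
decode-position-3 2F = 3F

h-marks-at-3 : ∀ {a b} → lookup (h a) 3F ≡ lookup (h b) 3F → a ≡ b
h-marks-at-3 {a} {b} eq = trans (sym (recover a)) (trans (cong decode-position-3 eq) (recover b))
  where
  recover : ∀ a → decode-position-3 (lookup (h a) 3F) ≡ a
  recover 0F = refl
  recover 1F = refl
  recover 2F = refl
  recover 3F = refl

window : Letter → Letter → ℕ → InfWord Letter
window a b r k = image^ 2 (pair a b) (r + k)

w-window : ∀ i {k} → k ≤ 49 → w (i + k) ≡ window (w (i / 49)) (w (suc (i / 49))) (i % 49) k
w-window i {k} k≤49 = begin
  w (i + k)                             ≡⟨ image^-fixed w-fixed 2 (i + k) ⟩
  image^ 2 w (i + k)                    ≡⟨ cong (λ x → image^ 2 w (x + k)) (m≡m%n+[m/n]*n i 49) ⟩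
  image^ 2 w (i % 49 + i / 49 * 49 + k) ≡⟨ image^-factor 2 w (i / 49) (m%n<n i 49) k≤49 ⟩
  window (w (i / 49)) (w (suc (i / 49))) (i % 49) k ∎
  where open ≡-Reasoning

followers : Letter → List Letter
followers 0F = 1F ∷ 2F ∷ 3F ∷ []
followers 1F = 0F ∷ []
followers 2F = 0F ∷ 3F ∷ []
followers 3F = 0F ∷ 1F ∷ []

follows : Letter → Letter → Bool
follows a b = ⌊ b ∈? followers a ⌋

follows-sound : ∀ a b → T (follows a b) → b ∈ followers a
follows-sound a b = toWitness {a? = b ∈? followers a}

everyOffset : (ℕ → InfWord Letter → Bool) → Letter → Letter → Bool
everyOffset P a b = all (λ r → P r (window a b r)) (downFrom 49)

everyWindow : (ℕ → InfWord Letter → Bool) → Bool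
everyWindow P = all (λ a → all (everyOffset P a) (followers a)) (allFin 4)

everyWindow-at : ∀ {P a b r} → T (everyWindow P) → b ∈ followers a → r < 49 →
                 T (P r (window a b r))
everyWindow-at {P} {a} {b} every b∈ r<49 =
  All.lookup (all⁺ (λ r → P r (window a b r)) (downFrom 49) at-a-b) (∈-downFrom⁺ r<49)
  where
  at-a : T (all (everyOffset P a) (followers a))
  at-a = All.lookup (all⁺ (λ a → all (everyOffset P a) (followers a)) (allFin 4) every) (∈-allFin a)
  at-a-b : T (everyOffset P a b)
  at-a-b = All.lookup (all⁺ (everyOffset P a) (followers a) at-a) b∈

-- The finite checks are stated as _ ≡ true and proved by refl: Agda then decides them by lazy
-- evaluation, which is far cheaper than solving a goal of type T _.
followers-closed : everyWindow (λ _ f → follows (f 0) (f 1)) ≡ true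
followers-closed = refl

w-followers : ∀ q → w (suc q) ∈ followers (w q)
w-followers = <-rec _ step
  where
  step : ∀ q → (∀ {y} → y < q → w (suc y) ∈ followers (w y)) → w (suc q) ∈ followers (w q)
  step zero      _   = here refl
  step q@(suc _) rec = subst₂ (λ x y → y ∈ followers x) (sym w-q) (sym w-suc-q)
    (follows-sound _ _ (everyWindow-at {λ _ f → follows (f 0) (f 1)}
                         (Equivalence.from T-≡ followers-closed) (rec (m/n<m q 49 (s<s z<s))) (m%n<n q 49)))
    where
    w-q : w q ≡ window (w (q / 49)) (w (suc (q / 49))) (q % 49) 0
    w-q = trans (cong w (sym (+-identityʳ q))) (w-window q z≤n)
    w-suc-q : w (suc q) ≡ window (w (q / 49)) (w (suc (q / 49))) (q % 49) 1
    w-suc-q = trans (cong w (+-comm 1 q)) (w-window q (s≤s z≤n))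

everyWindow-sound : ∀ P → everyWindow P ≡ true → ∀ i →
                    ∃ λ f → T (P (i % 49) f) × (∀ k → k < 50 → w (i + k) ≡ f k)
everyWindow-sound P check i =
  _ , everyWindow-at {P} (Equivalence.from T-≡ check) (w-followers (i / 49)) (m%n<n i 49)
    , λ k k<50 → w-window i (≤-pred k<50)

agreeOn : ℕ → InfWord Letter → InfWord Letter → Bool
agreeOn n f g = all (λ k → ⌊ f k ≟ᶠ g k ⌋) (downFrom n)

agreeOn-complete : ∀ n {f g} → (∀ k → k < n → f k ≡ g k) → T (agreeOn n f g)
agreeOn-complete n {f} {g} f≡g =
  all⁻ (λ k → ⌊ f k ≟ᶠ g k ⌋) (applyDownFrom⁺₁ id n λ {k} → fromWitness ∘ f≡g k)

T-not : ∀ {b} → T (not b) → ¬ T b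
T-not {false} _ ()

T-⇒ : ∀ {b c} → T (not b ∨ c) → T b → T c
T-⇒ {true} c _ = c

hasSquareOfPeriod : InfWord Letter → ℕ → Bool
hasSquareOfPeriod f n = agreeOn n f (λ k → f (n + k))

hasShortSquare : InfWord Letter → Bool
hasShortSquare f = any (λ n → hasSquareOfPeriod f (suc n)) (downFrom 11)

noShortSquare : ℕ → InfWord Letter → Bool
noShortSquare _ f = not (hasShortSquare f)

short-squares-absent : everyWindow noShortSquare ≡ true
short-squares-absent = refl

no-short-square : ∀ {i n} → 0 < n → n < 12 → ¬ Square w i n
no-short-square {i} {suc n} _ n<12 square =
  let f , no-square , w≡f = everyWindow-sound noShortSquare short-squares-absent i
      f-square : Square f 0 (suc n)
      f-square = square-transfer {g = w} {i = i} w≡f 2n≤50 square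
  in T-not no-square (any⁺ (λ n → hasSquareOfPeriod f (suc n))
                           (lose (∈-downFrom⁺ (≤-pred n<12)) (agreeOn-complete (suc n) f-square)))
  where
  2n≤50 : suc n + suc n ≤ 50
  2n≤50 = ≤-trans (+-mono-≤ (≤-pred n<12) (≤-pred n<12)) (m≤m+n 22 28)

samePhaseIfAgree : ℕ → InfWord Letter → ℕ → InfWord Letter → Bool
samePhaseIfAgree r f r′ g = not (agreeOn 12 f g) ∨ ⌊ r % 7 ≟ r′ % 7 ⌋

phases-synchronise : everyWindow (λ r f → everyWindow (samePhaseIfAgree r f)) ≡ true
phases-synchronise = refl

synchronised : ∀ i j → (∀ k → k < 12 → w (i + k) ≡ w (j + k)) → i % 7 ≡ j % 7
synchronised i j agree =
  let f , sync-f , w≡f =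
        everyWindow-sound (λ r f → everyWindow (samePhaseIfAgree r f)) phases-synchronise i
      g , sync-fg , w≡g =
        everyWindow-sound (samePhaseIfAgree (i % 49) f) (Equivalence.to T-≡ sync-f) j
      f≡g : ∀ k → k < 12 → f k ≡ g k
      f≡g k k<12 = trans (sym (w≡f k (<-≤-trans k<12 12≤50)))
                         (trans (agree k k<12) (w≡g k (<-≤-trans k<12 12≤50)))
  in begin
  i % 7       ≡⟨ m∣n⇒o%n%m≡o%m 7 49 i (divides 7 refl) ⟨
  i % 49 % 7  ≡⟨ toWitness (T-⇒ sync-fg (agreeOn-complete 12 f≡g)) ⟩
  j % 49 % 7  ≡⟨ m∣n⇒o%n%m≡o%m 7 49 j (divides 7 refl) ⟩
  j % 7       ∎
  where
  open ≡-Reasoning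
  12≤50 : 12 ≤ 50
  12≤50 = m≤m+n 12 38

long-square-period : ∀ {i n} → 12 ≤ n → Square w i n → 7 ∣ n
long-square-period {i} {n} 12≤n square =
  %-≡⇒∣ i n 7 (synchronised i (i + n) λ k k<12 → square k (<-≤-trans k<12 12≤n))

no-square : ∀ n {i} → 0 < n → ¬ Square w i n
no-square = <-rec _ step
  where
  step : ∀ n → (∀ {m} → m < n → ∀ {i} → 0 < m → ¬ Square w i m) →
         ∀ {i} → 0 < n → ¬ Square w i n
  step n rec {i} 0<n square = case n <? 12 of λ where
    (yes n<12) → no-short-square {i} 0<n n<12 square
    (no n≮12)  →
      let 12≤n : 12 ≤ n
          12≤n = ≮⇒≥ n≮12
          n≡n/7*7 : n ≡ n / 7 * 7
          n≡n/7*7 = sym (m/n*n≡m (long-square-period {i} 12≤n square))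
          j , square′ = square-descent w-fixed 3F h-marks-at-3 {i} (subst (Square w i) n≡n/7*7 square)
      in rec (m/n<m n 7 ⦃ >-nonZero 0<n ⦄ (s<s z<s)) {j}
             (m≥n⇒m/n>0 (≤-trans (m≤m+n 7 5) 12≤n)) square′

occursAtStart : InfWord Letter → List Letter → Bool
occursAtStart f u = all (λ k → ⌊ f (toℕ k) ≟ᶠ List.lookup u k ⌋) (allFin (length u))

occursAtStart-complete : ∀ u {f} → (∀ k → f (toℕ k) ≡ List.lookup u k) → T (occursAtStart f u)
occursAtStart-complete u {f} occurs =
  all⁻ (λ k → ⌊ f (toℕ k) ≟ᶠ List.lookup u k ⌋) (tabulate⁺ λ k → fromWitness (occurs k))

avoids : List Letter → ℕ → InfWord Letter → Bool
avoids u _ f = not (occursAtStart f u)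

shortAndAvoided : List Letter → Bool
shortAndAvoided u = (length u ≤ᵇ 50) ∧ everyWindow (avoids u)

not-factor : ∀ u → T (shortAndAvoided u) → ¬ IsFactor u w
not-factor u checked (i , occurs) =
  let short , absent = Equivalence.to T-∧ checked
      f , no-occurrence , w≡f = everyWindow-sound (avoids u) (Equivalence.to T-≡ absent) i
  in T-not no-occurrence (occursAtStart-complete u {f} λ k →
       trans (sym (w≡f (toℕ k) (<-≤-trans (toℕ<n k) (≤ᵇ⇒≤ _ _ short)))) (occurs k))

forbidden-absent : all shortAndAvoided forbidden ≡ true
forbidden-absent = refl

w-squarefree : SquareFree w
w-squarefree (i , n , 0<n , square) = no-square n {i} 0<n square

w-avoids-forbidden : All (λ u → ¬ IsFactor u w) forbidden
w-avoids-forbidden =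
  All.map (λ {u} → not-factor u)
          (all⁺ shortAndAvoided forbidden (Equivalence.from T-≡ forbidden-absent))

theorem1 : ∃ λ (w : InfWord Letter) →
             SquareFree w × All (λ u → ¬ IsFactor u w) forbidden
theorem1 = w , w-squarefree , w-avoids-forbidden
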